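{- Let $G=(V,E)$ be a finite simple undirected graph, let $k\ge 0$ be an integer and let $lb$ be an integer. If $\theta(G,k)\ge lb$ and there is an edge $\{u,v\}\in E$ such that $\omega(G[N(u)\cap N(v)])\le \theta(G,k)-3$, then $\theta(G,k)=\theta((V,E\setminus\{\{u,v\}\}),k)$.
   Context: $N(x)=\{w:\{x,w\}\in E\}$ is the open neighborhood. For $S\subseteq V$, $G[S]$ is the induced subgraph; $\omega(H)$ is the size of a largest clique in $H$; and for a graph $G$ and nonnegative integer $k$, $\theta(G,k)=\min_{S\subseteq V,\ |S|\le k}\omega(G[V\setminus S])$. -}

module Defs where

open import Data.Nat using (ℕ; _≤_)
open import Data.Bool using (Bool; true; false; _∧_; _∨_; not)
open import Data.Fin using (Fin; _≟_)
open import Data.Fin.Subset using (Subset; _∈_; _⊆_; ∁; _∩_; ∣_∣)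
open import Data.Vec using (tabulate)
open import Data.Product using (Σ; _×_)
open import Relation.Binary.PropositionalEquality using (_≡_; _≢_)
open import Relation.Nullary.Decidable using (⌊_⌋)

-- A graph on the vertex set V = Fin n, given by a Boolean adjacency
-- relation: adj x y ≡ true  iff  {x,y} ∈ E.
Graph : ℕ → Set
Graph n = Fin n → Fin n → Bool

IsSimple : ∀ {n} → Graph n → Set
IsSimple {n} G = (∀ (x y : Fin n) → G x y ≡ G y x) × (∀ (x : Fin n) → G x x ≡ false)

Edge : ∀ {n} → Graph n → Fin n → Fin n → Set
Edge G u v = G u v ≡ true

N : ∀ {n} → Graph n → Fin n → Subset n
N G x = tabulate (G x)

deleteEdge : ∀ {n} → Graph n → Fin n → Fin n → Graph n
deleteEdge G u v x y =
  G x y ∧ not ((⌊ x ≟ u ⌋ ∧ ⌊ y ≟ v ⌋) ∨ (⌊ x ≟ v ⌋ ∧ ⌊ y ≟ u ⌋))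

IsCliqueIn : ∀ {n} → Graph n → Subset n → Subset n → Set
IsCliqueIn {n} G S C =
  C ⊆ S × (∀ (x y : Fin n) → x ∈ C → y ∈ C → x ≢ y → G x y ≡ true)

IsOmega : ∀ {n} → Graph n → Subset n → ℕ → Set
IsOmega {n} G S w =
  Σ (Subset n) (λ C → IsCliqueIn G S C × ∣ C ∣ ≡ w)
  × (∀ (C : Subset n) → IsCliqueIn G S C → ∣ C ∣ ≤ w)

IsTheta : ∀ {n} → Graph n → ℕ → ℕ → Set
IsTheta {n} G k t =
  Σ (Subset n) (λ S → ∣ S ∣ ≤ k × IsOmega G (∁ S) t)
  × (∀ (S : Subset n) (w : ℕ) → ∣ S ∣ ≤ k → IsOmega G (∁ S) w → t ≤ w)

-- Every clique of G through both u and v lies, apart from u and v, in the common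
-- neighbourhood N(u) ∩ N(v), so it has at most ω(G[N(u) ∩ N(v)]) + 2 ≤ θ(G,k) − 1
-- vertices.  Hence deleting the edge uv destroys no clique of size ≥ θ(G,k), while
-- it creates no new cliques; since every induced subgraph G[V∖S] with |S| ≤ k has
-- clique number ≥ θ(G,k), all these clique numbers are unchanged, and so is θ.
module Submission where

open import Defs
open import Data.Nat using (ℕ; _+_; _≤_; zero; suc; s≤s)
open import Data.Nat.Properties
  using (≤-refl; ≤-trans; ≤-antisym; ≤-pred; ≤∧≢⇒<; <⇒≱; n≤0⇒n≡0; n≤1+n; +-comm)
  renaming (_≟_ to _≟ℕ_)
open import Data.Integer using (ℤ; +_) renaming (_≤_ to _≤ℤ_)
open import Data.Fin using (Fin; zero; suc; _≟_)
open import Data.Fin.Properties using (all?)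
open import Data.Fin.Subset using (Subset; ⊥; _∈_; _∉_; _⊆_; ∁; _∩_; _-_; ∣_∣; inside; outside)
open import Data.Fin.Subset.Properties
  using (_∈?_; ⊥⊆; ∉⊥; _⊆?_; anySubset?; x∈p∩q⁺; ∣p∣≤n; drop-there; p⊆q⇒∣p∣≤∣q∣; p─q⊆p; x∈p∧x≢y⇒x∈p-y)
open import Data.Vec using (_∷_; there; tail; tabulate)
open import Data.Vec.Properties using (lookup⇒[]=; lookup∘tabulate)
open import Data.Bool using (true; not; _∧_)
open import Data.Bool.Properties using (∧-conicalˡ; ∧-identityʳ) renaming (_≟_ to _≟𝔹_)
open import Data.Product using (Σ; _×_; _,_)
open import Data.Sum using (_⊎_; inj₁; inj₂)
open import Data.Empty using (⊥-elim)
open import Relation.Binary.PropositionalEquality using (_≡_; _≢_; refl; sym; trans; subst)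
open import Relation.Nullary using (¬_; Dec; yes; no; ¬?)
open import Relation.Nullary.Decidable using (_→-dec_; _×-dec_; _⊎-dec_; dec-false; isYes≗does)
open import Relation.Unary using (Pred; Decidable)

private variable
  n : ℕ

x∉p-x : (p : Subset n) (x : Fin n) → x ∉ p - x
x∉p-x (_ ∷ p) (suc x) (there x∈p-x) = x∉p-x p x x∈p-x

x∈p-y⇒x≢y : (p : Subset n) {x y : Fin n} → x ∈ p - y → x ≢ y
x∈p-y⇒x≢y p {x} x∈p-x refl = x∉p-x p x x∈p-x

-- Stated via membership: p─⊥≡p cannot be used to rewrite (s ∷ p) - zero, because the
-- auxiliary `diff` of _─_ is a where-function and its instances do not match syntactically.
p⊆tail[s∷p-zero] : ∀ s (p : Subset n) → p ⊆ tail ((s ∷ p) - zero)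
p⊆tail[s∷p-zero] s p x∈p = drop-there (x∈p∧x≢y⇒x∈p-y {p = s ∷ p} {y = zero} (there x∈p) λ ())

∣p∣≤1+∣p-x∣ : (p : Subset n) (x : Fin n) → ∣ p ∣ ≤ suc ∣ p - x ∣
∣p∣≤1+∣p-x∣ (inside  ∷ p) zero    = s≤s (p⊆q⇒∣p∣≤∣q∣ (p⊆tail[s∷p-zero] inside p))
∣p∣≤1+∣p-x∣ (outside ∷ p) zero    = ≤-trans (p⊆q⇒∣p∣≤∣q∣ (p⊆tail[s∷p-zero] outside p)) (n≤1+n _)
∣p∣≤1+∣p-x∣ (inside  ∷ p) (suc x) = s≤s (∣p∣≤1+∣p-x∣ p x)
∣p∣≤1+∣p-x∣ (outside ∷ p) (suc x) = ∣p∣≤1+∣p-x∣ p x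

-- IsOmega G S unfolds to IsMaxSize (IsCliqueIn G S).
IsMaxSize : ∀ {ℓ} → Pred (Subset n) ℓ → ℕ → Set ℓ
IsMaxSize {n} P m = Σ (Subset n) (λ C → P C × ∣ C ∣ ≡ m) × (∀ C → P C → ∣ C ∣ ≤ m)

maxSize : ∀ {ℓ} {P : Pred (Subset n) ℓ} → Decidable P → (C₀ : Subset n) → P C₀ →
  Σ ℕ (IsMaxSize P)
maxSize {n} {P = P} P? C₀ P₀ = search n (λ C _ → ∣p∣≤n C)
  where
  search : (m : ℕ) → (∀ C → P C → ∣ C ∣ ≤ m) → Σ ℕ (IsMaxSize P)
  search m bound with anySubset? (λ C → P? C ×-dec (∣ C ∣ ≟ℕ m))
  ... | yes attained = m , attained , bound
  search zero    bound | no unattained = ⊥-elim (unattained (C₀ , P₀ , n≤0⇒n≡0 (bound C₀ P₀)))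
  search (suc m) bound | no unattained = search m λ C PC →
    ≤-pred (≤∧≢⇒< (bound C PC) λ ∣C∣≡1+m → unattained (C , PC , ∣C∣≡1+m))

module _ (G : Graph n) where

  isClique? : (S C : Subset n) → Dec (IsCliqueIn G S C)
  isClique? S C = (C ⊆? S) ×-dec all? λ x → all? λ y →
    (x ∈? C) →-dec (y ∈? C) →-dec ¬? (x ≟ y) →-dec (G x y ≟𝔹 true)

  emptyClique : (S : Subset n) → IsCliqueIn G S ⊥
  emptyClique S = ⊥⊆ , λ _ _ x∈⊥ → ⊥-elim (∉⊥ x∈⊥)

  omega-exists : (S : Subset n) → Σ ℕ (IsOmega G S)
  omega-exists S = maxSize (isClique? S) ⊥ (emptyClique S)

  omega-unique : ∀ {S a b} → IsOmega G S a → IsOmega G S b → a ≡ b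
  omega-unique ((A , A-clique , refl) , ≤a) ((B , B-clique , refl) , ≤b) =
    ≤-antisym (≤b A A-clique) (≤a B B-clique)

  N-intro : ∀ {x y} → G x y ≡ true → y ∈ N G x
  N-intro {x} {y} Gxy = lookup⇒[]= y (tabulate (G x)) (trans (lookup∘tabulate (G x) y) Gxy)

  clique-minus-u-v : ∀ {S C u v} → IsCliqueIn G S C → u ∈ C → v ∈ C →
    IsCliqueIn G (N G u ∩ N G v) (C - u - v)
  clique-minus-u-v {C = C} {u} {v} (_ , adjacent) u∈C v∈C =
    inCommonN , λ x y x∈ y∈ → adjacent x y (∈C x∈) (∈C y∈)
    where
    ∈C : ∀ {x} → x ∈ C - u - v → x ∈ C
    ∈C x∈ = p─q⊆p C _ (p─q⊆p (C - u) _ x∈)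
    inCommonN : C - u - v ⊆ N G u ∩ N G v
    inCommonN {x} x∈ = x∈p∩q⁺
      ( N-intro (adjacent u x u∈C (∈C x∈) λ u≡x → x∈p-y⇒x≢y C (p─q⊆p (C - u) _ x∈) (sym u≡x))
      , N-intro (adjacent v x v∈C (∈C x∈) λ v≡x → x∈p-y⇒x≢y (C - u) x∈ (sym v≡x)))

  clique-through-u-v-size : ∀ {S C u v w} → IsOmega G (N G u ∩ N G v) w →
    IsCliqueIn G S C → u ∈ C → v ∈ C → ∣ C ∣ ≤ 2 + w
  clique-through-u-v-size {C = C} {u} {v} (_ , ≤w) C-clique u∈C v∈C =
    ≤-trans (∣p∣≤1+∣p-x∣ C u) (s≤s (≤-trans (∣p∣≤1+∣p-x∣ (C - u) v)
      (s≤s (≤w (C - u - v) (clique-minus-u-v C-clique u∈C v∈C)))))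

module _ (G : Graph n) (u v : Fin n) where

  deleteEdge-⊆ : ∀ {x y} → deleteEdge G u v x y ≡ true → G x y ≡ true
  deleteEdge-⊆ {x} {y} = ∧-conicalˡ (G x y) _

  deleteEdge-≡ : ∀ {x y} → ¬ ((x ≡ u × y ≡ v) ⊎ (x ≡ v × y ≡ u)) → deleteEdge G u v x y ≡ G x y
  deleteEdge-≡ {x} {y} ¬uv
    rewrite isYes≗does (x ≟ u) | isYes≗does (y ≟ v) | isYes≗does (x ≟ v) | isYes≗does (y ≟ u)
          | dec-false ((x ≟ u ×-dec y ≟ v) ⊎-dec (x ≟ v ×-dec y ≟ u)) ¬uv
    = ∧-identityʳ (G x y)

  deleteEdge-clique⁻ : ∀ {S C} → IsCliqueIn (deleteEdge G u v) S C → IsCliqueIn G S C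
  deleteEdge-clique⁻ (C⊆S , adjacent) =
    C⊆S , λ x y x∈C y∈C x≢y → deleteEdge-⊆ (adjacent x y x∈C y∈C x≢y)

  deleteEdge-clique⁺ : ∀ {S C} → IsCliqueIn G S C → ¬ (u ∈ C × v ∈ C) →
    IsCliqueIn (deleteEdge G u v) S C
  deleteEdge-clique⁺ {C = C} (C⊆S , adjacent) ¬uv∈C = C⊆S , λ x y x∈C y∈C x≢y →
    trans (deleteEdge-≡ (λ { (inj₁ (refl , refl)) → ¬uv∈C (x∈C , y∈C)
                           ; (inj₂ (refl , refl)) → ¬uv∈C (y∈C , x∈C) }))
          (adjacent x y x∈C y∈C x≢y)

  large-clique-survives : ∀ {S C w} → IsOmega G (N G u ∩ N G v) w →
    IsCliqueIn G S C → w + 3 ≤ ∣ C ∣ → IsCliqueIn (deleteEdge G u v) S C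
  large-clique-survives {C = C} {w} ω C-clique large =
    deleteEdge-clique⁺ C-clique λ (u∈C , v∈C) →
      <⇒≱ (subst (_≤ ∣ C ∣) (+-comm w 3) large) (clique-through-u-v-size G ω C-clique u∈C v∈C)

module _ {G H : Graph n} {t : ℕ}
  (fewer : ∀ {S C} → IsCliqueIn H S C → IsCliqueIn G S C)
  (large : ∀ {S C} → IsCliqueIn G S C → t ≤ ∣ C ∣ → IsCliqueIn H S C) where

  omega-transfer : ∀ {S m} → IsOmega G S m → t ≤ m → IsOmega H S m
  omega-transfer ((C , C-clique , refl) , ≤m) t≤m = 
    (C , large C-clique t≤m , refl) , λ D D-clique → ≤m D (fewer D-clique)

  theta-transfer : ∀ {k} → IsTheta G k t → IsTheta H k t
  theta-transfer ((S₀ , ∣S₀∣≤k , ω₀) , minimal) =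
    (S₀ , ∣S₀∣≤k , omega-transfer ω₀ ≤-refl) , λ S _ ∣S∣≤k ωH →
    let (m , ωG) = omega-exists G (∁ S)
        t≤m = minimal S m ∣S∣≤k ωG
    in subst (t ≤_) (omega-unique H (omega-transfer ωG t≤m) ωH) t≤m

lemma6 : ∀ {n : ℕ} (G : Graph n) → IsSimple G → (k : ℕ) (lb : ℤ) (t : ℕ) →
    IsTheta G k t → lb ≤ℤ + t →
    (u v : Fin n) → Edge G u v →
    (w : ℕ) → IsOmega G (N G u ∩ N G v) w → w + 3 ≤ t →
    IsTheta (deleteEdge G u v) k t
lemma6 G _ _ _ _ θ _ u v _ _ ω w+3≤t =
  theta-transfer (deleteEdge-clique⁻ G u v)
    (λ C-clique t≤∣C∣ → large-clique-survives G u v ω C-clique (≤-trans w+3≤t t≤∣C∣)) θ
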